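{- Consider an interpreted system $\mathcal{I}$ over the gathering language, and set the set of possible choices $\mathcal{V}$ to be the set of rendezvous regions $P_{rz(X)}$, with, for each robot $r$ and $U\in P_{rz(X)}$: $\mathrm{choose}_r(U)\leftrightarrow\bigvee_{x\in P_{g(X)}}(\mathrm{pos}_r(x)\wedge(x\in U))$, $\mathrm{decide}_r(U):=\Box\,\mathrm{choose}_r(U)$, and $\mathrm{init}_r(U)\leftrightarrow\bigvee_{x\in P_{g(X)}}(\mathrm{init}(\mathrm{pos}_r(x))\wedge(x\in U))$. If $\mathcal{I}$ is consistent with stabilizing agreement, i.e. (Agreement) $\mathcal{I}\models\bigvee_{U\in P_{rz(X)}}\bigwedge_{r\in\Pi}\Diamond\,\mathrm{decide}_r(U)$ and (Validity) $\mathcal{I}\models\bigwedge_{U\in P_{rz(X)}}\big(\mathrm{choose}_r(U)\to K_r\bigvee_{r'\in\Pi}\mathrm{init}_{r'}(U)\big)$ for every $r\in\Pi$, then $\mathcal{I}$ is consistent with approximate gathering, i.e. (Eventual Gathering) $\mathcal{I}\models\bigvee_{U\in P_{rz(X)}}\bigwedge_{r\in\Pi}\Diamond\Box\bigvee_{x\in P_{g(X)}}(\mathrm{pos}_r(x)\wedge(x\in U))$ and (Starting Validity) for every $U\in P_{rz(X)}$ and every $\vec x=(x_r)_{r\in\Pi}\in P_{g(X)}^{\Pi}$: $\mathcal{I}\models\Big(\bigwedge_{r\in\Pi}\big(\mathrm{init}(\mathrm{pos}_r(x_r))\wedge(x_r\in U)\big)\Big)\to\Diamond\Box\bigvee_{\vec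 y\in P_{g(X)}^{\Pi}}\bigwedge_{r\in\Pi}\big(\mathrm{pos}_r(y_r)\wedge(y_r\in U)\big)$.
   Context: $\Pi$ is a finite set of robots; $X\subseteq[0,1]^k$ is compact. An interpreted system $\mathcal{I}$ is a set of runs, each a sequence of global configurations indexed by discrete time $[t]\in\mathbb{N}$; points are pairs $(\rho,[t])$; $(\rho,[t])\sim_r(\rho',[t'])$ iff robot $r$ has the same epistemic (memory) state at both points; $K_r\varphi$ holds at a point iff $\varphi$ holds at all $\sim_r$-related points; $\Diamond\varphi$ holds at $(\rho,[t])$ iff $\varphi$ holds at $(\rho,[t'])$ for some $[t']\ge[t]$; $\Box=\neg\Diamond\neg$; $\mathcal{I}\models\varphi$ means $\varphi$ holds at every point. $P_{g(X)}\subseteq X$ is a finite set of discretized positions (the finite range of the robots' position observations). $P_{rz(X)}$ is a finite set of pairwise disjoint regions of $X$ (rendezvous regions). The atoms are: $\mathrm{pos}_r(x)$ for $x\in P_{g(X)}$ ("robot $r$ is at discretized position $x$", evaluated at the current point), $\mathrm{init}(\mathrm{pos}_r(x))$ (true at $(\rho,[t])$ iff $\mathrm{pos}_r(x)$ holds at $(\rho,0)$), and inclusion atoms $(x\in U)$ for $x\in P_{g(X)}$, $U\in P_{rz(X)}$, all evaluated by a valuation. Standing assumptions: robots know their own position, $\mathrm{pos}_r(x)\leftrightarrow K_r\mathrm{pos}_r(x)$; no robot can be in two rendezvous regions at once, $\mathrm{pos}_r(x)\wedge(x\in U)\to\bigwedge_{V\in P_{rz(X)},V\neq U}\neg(x\in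 V)$; each robot starts in one rendezvous region. -}

module Defs where

open import Data.Nat using (ℕ; _≤_)
open import Data.Fin using (Fin)
open import Data.Product using (Σ; _×_; ∃)
open import Relation.Binary.PropositionalEquality using (_≡_)
open import Relation.Nullary using (¬_)

-- Robots Π = Fin n, discretized positions P_g(X) = Fin m,
-- rendezvous regions P_rz(X) = Fin k.
record InterpretedSystem (n m : ℕ) : Set₁ where
  field
    Run      : Set
    EState   : Set
    estate   : Run → ℕ → Fin n → EState
    position : Run → ℕ → Fin n → Fin m
open InterpretedSystem public

Fml : ∀ {n m} → InterpretedSystem n m → Set₁
Fml I = Run I → ℕ → Set

_⊨_ : ∀ {n m} (I : InterpretedSystem n m) → Fml I → Set
I ⊨ φ = ∀ ρ t → φ ρ t

◇ : ∀ {n m} {I : InterpretedSystem n m} → Fml I → Fml I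
◇ φ ρ t = ∃ λ t′ → t ≤ t′ × φ ρ t′

□ : ∀ {n m} {I : InterpretedSystem n m} → Fml I → Fml I
□ φ ρ t = ∀ t′ → t ≤ t′ → φ ρ t′

K : ∀ {n m} (I : InterpretedSystem n m) → Fin n → Fml I → Fml I
K I r φ ρ t = ∀ ρ′ t′ → estate I ρ′ t′ r ≡ estate I ρ t r → φ ρ′ t′

pos : ∀ {n m} (I : InterpretedSystem n m) → Fin n → Fin m → Fml I
pos I r x ρ t = position I ρ t r ≡ x

initPos : ∀ {n m} (I : InterpretedSystem n m) → Fin n → Fin m → Fml I
initPos I r x ρ t = pos I r x ρ 0

module _ {n m k : ℕ} (I : InterpretedSystem n m) (_∈R_ : Fin m → Fin k → Set) where

  choose : Fin n → Fin k → Fml I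
  choose r U ρ t = Σ (Fin m) λ x → pos I r x ρ t × x ∈R U

  decide : Fin n → Fin k → Fml I
  decide r U = □ {I = I} (choose r U)

  initR : Fin n → Fin k → Fml I
  initR r U ρ t = Σ (Fin m) λ x → initPos I r x ρ t × x ∈R U

  KnowsOwnPosition : Set
  KnowsOwnPosition = ∀ r x → I ⊨ λ ρ t →
    (pos I r x ρ t → K I r (pos I r x) ρ t) × (K I r (pos I r x) ρ t → pos I r x ρ t)

  NoTwoRegions : Set
  NoTwoRegions = ∀ r x U → I ⊨ λ ρ t →
    pos I r x ρ t → x ∈R U → ∀ V → ¬ (V ≡ U) → ¬ (x ∈R V)

  StartsInRegion : Set
  StartsInRegion = ∀ (ρ : Run I) (r : Fin n) →
    Σ (Fin k) λ U → Σ (Fin m) λ x → pos I r x ρ 0 × x ∈R U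

  Agreement : Set
  Agreement = I ⊨ λ ρ t → Σ (Fin k) λ U → ∀ r → ◇ {I = I} (decide r U) ρ t

  Validity : Set
  Validity = ∀ (r : Fin n) → I ⊨ λ ρ t → ∀ (U : Fin k) →
    choose r U ρ t → K I r (λ ρ′ t′ → Σ (Fin n) λ r′ → initR r′ U ρ′ t′) ρ t

  EventualGathering : Set
  EventualGathering = I ⊨ λ ρ t → Σ (Fin k) λ U → ∀ r →
    ◇ {I = I} (□ {I = I} (λ ρ′ t′ → Σ (Fin m) λ x → pos I r x ρ′ t′ × x ∈R U)) ρ t

  StartingValidity : Set
  StartingValidity = ∀ (U : Fin k) (xs : Fin n → Fin m) → I ⊨ λ ρ t →
    (∀ r → initPos I r (xs r) ρ t × xs r ∈R U) →
    ◇ {I = I} (□ {I = I} (λ ρ′ t′ → Σ (Fin n → Fin m) λ ys →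
      ∀ r → pos I r (ys r) ρ′ t′ × ys r ∈R U)) ρ t

{-# OPTIONS --safe #-}
-- Eventual gathering is agreement itself, since decide_r(U) unfolds to □ choose_r(U).
-- For starting validity, let U′ be the agreed region. After the latest of the
-- robots' decision times every robot keeps choosing U′, so by validity (and the
-- truth of knowledge) some robot started in U′; all robots started in U, and no
-- position lies in two regions, hence U′ = U.
module Submission where

open import Defs
open import Data.Nat using (ℕ; zero; suc; _≤_; _⊔_)
open import Data.Nat.Properties using (≤-refl; ≤-trans; m≤m⊔n; m≤n⊔m)
open import Data.Fin using (Fin; zero; suc; _≟_)
open import Data.Product using (_×_; Σ; _,_; proj₁; proj₂)
open import Function using (_∘_)
open import Relation.Nullary using (yes; no; contradiction)
open import Relation.Binary.PropositionalEquality using (_≡_; refl; sym; trans; subst)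

EventuallyAlways : (ℕ → Set) → ℕ → Set
EventuallyAlways P t = Σ ℕ λ s → t ≤ s × ∀ u → s ≤ u → P u

module _ {P Q : ℕ → Set} {t : ℕ} where

  eventuallyAlways-map : (∀ u → P u → Q u) → EventuallyAlways P t → EventuallyAlways Q t
  eventuallyAlways-map P⇒Q (s , t≤s , always) = s , t≤s , λ u s≤u → P⇒Q u (always u s≤u)

  eventuallyAlways-× : EventuallyAlways P t → EventuallyAlways Q t →
    EventuallyAlways (λ u → P u × Q u) t
  eventuallyAlways-× (s , t≤s , alwaysP) (s′ , _ , alwaysQ) =
    s ⊔ s′ , ≤-trans t≤s (m≤m⊔n s s′) ,
    λ u s⊔s′≤u → alwaysP u (≤-trans (m≤m⊔n s s′) s⊔s′≤u) , alwaysQ u (≤-trans (m≤n⊔m s s′) s⊔s′≤u)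

eventuallyAlways-all : ∀ {j} {P : Fin j → ℕ → Set} {t} →
  (∀ i → EventuallyAlways (P i) t) → EventuallyAlways (λ u → ∀ i → P i u) t
eventuallyAlways-all {zero} {t = t} _ = t , ≤-refl , λ _ _ ()
eventuallyAlways-all {suc j} {P} evP =
  eventuallyAlways-map cons (eventuallyAlways-× (evP zero) (eventuallyAlways-all (evP ∘ suc)))
  where
  cons : ∀ u → P zero u × (∀ i → P (suc i) u) → ∀ i → P i u
  cons _ (P₀ , Pₛ) zero    = P₀
  cons _ (P₀ , Pₛ) (suc i) = Pₛ i

K-truth : ∀ {n m} (I : InterpretedSystem n m) r {φ : Fml I} {ρ t} → K I r φ ρ t → φ ρ t
K-truth _ _ Kφ = Kφ _ _ refl

module _ {n m k : ℕ} (I : InterpretedSystem n m) (_∈R_ : Fin m → Fin k → Set) where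

  StartAllIn : Fin k → (Fin n → Fin m) → Run I → Set
  StartAllIn U xs ρ = ∀ r → pos I r (xs r) ρ 0 × xs r ∈R U

  initR⇒start-region : NoTwoRegions I _∈R_ →
    ∀ {U xs ρ r U′} → StartAllIn U xs ρ → initR I _∈R_ r U′ ρ 0 → U′ ≡ U
  initR⇒start-region noTwo {U} {xs} {ρ} {r} {U′} start (x , startAt-x , x∈U′)
    with U′ ≟ U | start r
  ... | yes U′≡U | _ = U′≡U
  ... | no  U′≢U | startAt-xs-r , xs-r∈U =
    contradiction (subst (_∈R U′) (trans (sym startAt-x) startAt-xs-r) x∈U′)
                  (noTwo r (xs r) U ρ 0 startAt-xs-r xs-r∈U U′ U′≢U)

  choose⇒start-region : NoTwoRegions I _∈R_ → Validity I _∈R_ →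
    ∀ {U xs ρ t r U′} → StartAllIn U xs ρ → choose I _∈R_ r U′ ρ t → U′ ≡ U
  choose⇒start-region noTwo valid {ρ = ρ} {t} {r} {U′} start chosen =
    initR⇒start-region noTwo start (proj₂ (K-truth I r (valid r ρ t U′ chosen)))

  choose-all⇒positions : ∀ {U ρ t} → (∀ r → choose I _∈R_ r U ρ t) →
    Σ (Fin n → Fin m) λ ys → ∀ r → pos I r (ys r) ρ t × ys r ∈R U
  choose-all⇒positions chosen = (λ r → proj₁ (chosen r)) , λ r → proj₂ (chosen r)

mainTheorem10 : ∀ {n m k : ℕ} (I : InterpretedSystem n m) (_∈R_ : Fin m → Fin k → Set) →
    KnowsOwnPosition I _∈R_ → NoTwoRegions I _∈R_ → StartsInRegion I _∈R_ →
    Agreement I _∈R_ → Validity I _∈R_ →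
    EventualGathering I _∈R_ × StartingValidity I _∈R_
mainTheorem10 {n} {m} I _∈R_ _ noTwo _ agreement valid = agreement , startingValidity
  where
  startingValidity : StartingValidity I _∈R_
  startingValidity U xs ρ t start with agreement ρ t
  ... | U′ , decided = eventuallyAlways-map gathered (eventuallyAlways-all decided)
    where
    gathered : ∀ t′ → (∀ r → choose I _∈R_ r U′ ρ t′) →
      Σ (Fin n → Fin m) λ ys → ∀ r → pos I r (ys r) ρ t′ × ys r ∈R U
    gathered t′ chosen = choose-all⇒positions I _∈R_ λ r →
      subst (λ V → choose I _∈R_ r V ρ t′)
            (choose⇒start-region I _∈R_ noTwo valid start (chosen r)) (chosen r)
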